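{- Let $K$ be an $r$-dimensional simplicial complex containing no $r$-dimensional wheel. Then for every $r$-face $F$ of $K$ and every vertex $u$ of $K$ with $u\notin F$, we have $|N^{\mathrm d}(F,u)|\le 1$.
   Context: A simplicial complex is a family of subsets of a vertex set closed under taking subsets; an $i$-face has size $i+1$; $S_r(K)$ is the set of $r$-faces. For an $r$-face $F$ and vertex $u\notin F$, $N^{\mathrm d}(F,u)=\{G\cup\{u\}\in S_r(K): G\subset F,\ |G|=r\}$. $K$ contains an $r$-dimensional wheel if there exist an $(r-1)$-set $S$ of vertices and distinct vertices $v_1,\dots,v_k\notin S$, $k\ge 3$, such that $S\cup\{v_i,v_{i+1}\}\in S_r(K)$ for all $i$ (indices mod $k$); i.e. $K$ contains a copy of the join of an $(r-2)$-simplex with a cycle. -}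

module Defs where

open import Data.Nat using (ℕ; suc; _+_; _≤_)
open import Data.Fin using (Fin; zero; suc; inject₁; fromℕ)
open import Data.Fin.Subset using (Subset; _⊆_; _∉_; _∪_; ⁅_⁆; ∣_∣)
open import Data.Product using (Σ; ∃; _×_)
open import Function.Definitions using (Injective)
open import Relation.Binary.PropositionalEquality using (_≡_)

record SimplicialComplex (n : ℕ) : Set₁ where
  field
    face        : Subset n → Set
    down-closed : ∀ {A B} → A ⊆ B → face B → face A

open SimplicialComplex public

Sface : ∀ {n} → ℕ → SimplicialComplex n → Subset n → Set
Sface r K A = face K A × ∣ A ∣ ≡ suc r

IsDim : ∀ {n} → SimplicialComplex n → ℕ → Set
IsDim K r = (∀ A → face K A → ∣ A ∣ ≤ suc r) × ∃ λ A → Sface r K A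

IsVertex : ∀ {n} → SimplicialComplex n → Fin n → Set
IsVertex K u = face K ⁅ u ⁆

Nd : ∀ {n} → SimplicialComplex n → ℕ → Subset n → Fin n → Subset n → Set
Nd K r F u X =
  ∃ λ G → G ⊆ F × ∣ G ∣ ≡ r × X ≡ G ∪ ⁅ u ⁆ × Sface r K X

AtMostOne : ∀ {n} → (Subset n → Set) → Set
AtMostOne P = ∀ X Y → P X → P Y → X ≡ Y

-- K contains an r-dimensional wheel: an (r-1)-set S and distinct vertices
-- v_0, …, v_{k-1} ∉ S with k = 3 + m ≥ 3, such that S ∪ {v_i, v_{i+1}} ∈ S_r(K)
-- for all i (indices mod k).
HasWheel : ∀ {n} → SimplicialComplex n → ℕ → Set
HasWheel {n} K r =
  Σ (Subset n) λ S → Σ ℕ λ m → Σ (Fin (3 + m) → Fin n) λ v →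
    (∣ S ∣ + 1 ≡ r)
    × Injective _≡_ _≡_ v
    × (∀ i → v i ∉ S)
    × (∀ (i : Fin (2 + m)) → Sface r K (S ∪ (⁅ v (inject₁ i) ⁆ ∪ ⁅ v (suc i) ⁆)))
    × Sface r K (S ∪ (⁅ v (fromℕ (2 + m)) ⁆ ∪ ⁅ v zero ⁆))

{-# OPTIONS --safe #-}
module Submission where

-- Let X = G₁ ∪ {u} and Y = G₂ ∪ {u} be distinct members of N^d(F,u), and pick
-- a ∈ G₂ ∖ G₁, b ∈ G₁ ∖ G₂.  Then G₁ ∪ G₂ = F, so S = G₁ ∩ G₂ has r − 1 elements,
-- and the faces F, X, Y contain S ∪ {a,b}, S ∪ {b,u}, S ∪ {u,a}: a wheel with
-- hub S whose rim is the triangle a b u.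

open import Defs
open import Data.Nat using (ℕ; suc; _+_; _≤_)
open import Data.Nat.Properties using (+-suc; +-comm; +-cancelˡ-≡; ≤-antisym; ≤-reflexive; <⇒≱)
open import Data.Fin using (Fin; zero; suc; inject₁)
open import Data.Fin.Properties using (any?)
open import Data.Fin.Subset
open import Data.Fin.Subset.Properties
open import Data.Vec using ([]; _∷_; here)
open import Data.Bool using (true; false)
open import Data.Product using (∃; _×_; _,_)
open import Data.Sum using (_⊎_; inj₁; inj₂)
open import Data.Empty using (⊥-elim)
open import Relation.Nullary using (¬_; yes; no)
open import Relation.Nullary.Decidable using (¬?; _×-dec_; decidable-stable)
open import Relation.Binary.PropositionalEquality
open import Function using (_∘_)

private variable
  n : ℕ
  p q t : Subset n
  x y : Fin n

∃∈∖⊎⊆ : (p q : Subset n) → (∃ λ x → x ∈ p × x ∉ q) ⊎ p ⊆ q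
∃∈∖⊎⊆ p q with any? (λ x → x ∈? p ×-dec ¬? (x ∈? q))
... | yes witness = inj₁ witness
... | no  none    = inj₂ λ {x} x∈p → decidable-stable (x ∈? q) (λ x∉q → none (x , x∈p , x∉q))

p⊆q∧∣q∣≤∣p∣⇒p≡q : p ⊆ q → ∣ q ∣ ≤ ∣ p ∣ → p ≡ q
p⊆q∧∣q∣≤∣p∣⇒p≡q {p = p} {q = q} p⊆q ∣q∣≤∣p∣ with ∃∈∖⊎⊆ q p
... | inj₁ (x , x∈q , x∉p) = ⊥-elim (<⇒≱ (p⊂q⇒∣p∣<∣q∣ (p⊆q , x , x∈q , x∉p)) ∣q∣≤∣p∣)
... | inj₂ q⊆p             = ⊆-antisym p⊆q q⊆p

∪-lub : p ⊆ t → q ⊆ t → p ∪ q ⊆ t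
∪-lub {p = p} {q = q} p⊆t q⊆t x∈p∪q with x∈p∪q⁻ p q x∈p∪q
... | inj₁ x∈p = p⊆t x∈p
... | inj₂ x∈q = q⊆t x∈q

x∈p⇒⁅x⁆⊆p : x ∈ p → ⁅ x ⁆ ⊆ p
x∈p⇒⁅x⁆⊆p {x = x} x∈p y∈⁅x⁆ rewrite x∈⁅y⁆⇒x≡y x y∈⁅x⁆ = x∈p

p∪⁅x,y⁆⊆t : p ⊆ t → x ∈ t → y ∈ t → p ∪ (⁅ x ⁆ ∪ ⁅ y ⁆) ⊆ t
p∪⁅x,y⁆⊆t p⊆t x∈t y∈t = ∪-lub p⊆t (∪-lub (x∈p⇒⁅x⁆⊆p x∈t) (x∈p⇒⁅x⁆⊆p y∈t))

∣p∪q∣+∣p∩q∣≡∣p∣+∣q∣ : (p q : Subset n) → ∣ p ∪ q ∣ + ∣ p ∩ q ∣ ≡ ∣ p ∣ + ∣ q ∣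
∣p∪q∣+∣p∩q∣≡∣p∣+∣q∣ []          []          = refl
∣p∪q∣+∣p∩q∣≡∣p∣+∣q∣ (false ∷ p) (false ∷ q) = ∣p∪q∣+∣p∩q∣≡∣p∣+∣q∣ p q
∣p∪q∣+∣p∩q∣≡∣p∣+∣q∣ (true  ∷ p) (false ∷ q) = cong suc (∣p∪q∣+∣p∩q∣≡∣p∣+∣q∣ p q)
∣p∪q∣+∣p∩q∣≡∣p∣+∣q∣ (false ∷ p) (true  ∷ q) =
  trans (cong suc (∣p∪q∣+∣p∩q∣≡∣p∣+∣q∣ p q)) (sym (+-suc ∣ p ∣ ∣ q ∣))
∣p∪q∣+∣p∩q∣≡∣p∣+∣q∣ (true  ∷ p) (true  ∷ q) = cong suc (begin
  ∣ p ∪ q ∣ + suc ∣ p ∩ q ∣ ≡⟨ +-suc ∣ p ∪ q ∣ ∣ p ∩ q ∣ ⟩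
  suc (∣ p ∪ q ∣ + ∣ p ∩ q ∣) ≡⟨ cong suc (∣p∪q∣+∣p∩q∣≡∣p∣+∣q∣ p q) ⟩
  suc (∣ p ∣ + ∣ q ∣)         ≡⟨ +-suc ∣ p ∣ ∣ q ∣ ⟨
  ∣ p ∣ + suc ∣ q ∣           ∎)
  where open ≡-Reasoning

x∉p⇒∣p∪⁅x⁆∣≡1+∣p∣ : x ∉ p → ∣ p ∪ ⁅ x ⁆ ∣ ≡ suc ∣ p ∣
x∉p⇒∣p∪⁅x⁆∣≡1+∣p∣ {x = zero}  {p = false ∷ p} _   = cong (λ s → suc ∣ s ∣) (∪-identityʳ p)
x∉p⇒∣p∪⁅x⁆∣≡1+∣p∣ {x = zero}  {p = true  ∷ p} x∉p = ⊥-elim (x∉p here)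
x∉p⇒∣p∪⁅x⁆∣≡1+∣p∣ {x = suc x} {p = false ∷ p} x∉p = x∉p⇒∣p∪⁅x⁆∣≡1+∣p∣ (drop-not-there x∉p)
x∉p⇒∣p∪⁅x⁆∣≡1+∣p∣ {x = suc x} {p = true  ∷ p} x∉p = cong suc (x∉p⇒∣p∪⁅x⁆∣≡1+∣p∣ (drop-not-there x∉p))

∣p∪⁅x,y⁆∣≡2+∣p∣ : x ∉ p → y ∉ p → x ≢ y → ∣ p ∪ (⁅ x ⁆ ∪ ⁅ y ⁆) ∣ ≡ 2 + ∣ p ∣
∣p∪⁅x,y⁆∣≡2+∣p∣ {x = x} {p = p} {y = y} x∉p y∉p x≢y = begin
  ∣ p ∪ (⁅ x ⁆ ∪ ⁅ y ⁆) ∣ ≡⟨ cong ∣_∣ (∪-assoc p ⁅ x ⁆ ⁅ y ⁆) ⟨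
  ∣ (p ∪ ⁅ x ⁆) ∪ ⁅ y ⁆ ∣ ≡⟨ x∉p⇒∣p∪⁅x⁆∣≡1+∣p∣ y∉p∪⁅x⁆ ⟩
  suc ∣ p ∪ ⁅ x ⁆ ∣       ≡⟨ cong suc (x∉p⇒∣p∪⁅x⁆∣≡1+∣p∣ x∉p) ⟩
  2 + ∣ p ∣               ∎
  where
  open ≡-Reasoning
  y∉p∪⁅x⁆ : y ∉ p ∪ ⁅ x ⁆
  y∉p∪⁅x⁆ y∈p∪⁅x⁆ with x∈p∪q⁻ p ⁅ x ⁆ y∈p∪⁅x⁆
  ... | inj₁ y∈p   = y∉p y∈p
  ... | inj₂ y∈⁅x⁆ = x≢y (sym (x∈⁅y⁆⇒x≡y x y∈⁅x⁆))

distinct-r-subsets⇒∣∩∣+1≡r : ∀ {r} {F G₁ G₂ : Subset n} {a : Fin n} →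
  G₁ ⊆ F → G₂ ⊆ F → ∣ F ∣ ≡ suc r → ∣ G₁ ∣ ≡ r → ∣ G₂ ∣ ≡ r → a ∈ G₂ → a ∉ G₁ →
  ∣ G₁ ∩ G₂ ∣ + 1 ≡ r
distinct-r-subsets⇒∣∩∣+1≡r {r = r} {G₁ = G₁} {G₂} {a} G₁⊆F G₂⊆F ∣F∣≡1+r ∣G₁∣≡r ∣G₂∣≡r a∈G₂ a∉G₁ =
  +-cancelˡ-≡ r (∣ G₁ ∩ G₂ ∣ + 1) r (begin
    r + (∣ G₁ ∩ G₂ ∣ + 1)     ≡⟨ cong (r +_) (+-comm ∣ G₁ ∩ G₂ ∣ 1) ⟩
    r + suc ∣ G₁ ∩ G₂ ∣       ≡⟨ +-suc r ∣ G₁ ∩ G₂ ∣ ⟩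
    suc r + ∣ G₁ ∩ G₂ ∣       ≡⟨ cong (_+ ∣ G₁ ∩ G₂ ∣) ∣G₁∪G₂∣≡1+r ⟨
    ∣ G₁ ∪ G₂ ∣ + ∣ G₁ ∩ G₂ ∣ ≡⟨ ∣p∪q∣+∣p∩q∣≡∣p∣+∣q∣ G₁ G₂ ⟩
    ∣ G₁ ∣ + ∣ G₂ ∣           ≡⟨ cong₂ _+_ ∣G₁∣≡r ∣G₂∣≡r ⟩
    r + r                     ∎)
  where
  open ≡-Reasoning
  ∣G₁∪G₂∣≡1+r : ∣ G₁ ∪ G₂ ∣ ≡ suc r
  ∣G₁∪G₂∣≡1+r = ≤-antisym
    (subst (∣ G₁ ∪ G₂ ∣ ≤_) ∣F∣≡1+r (p⊆q⇒∣p∣≤∣q∣ (∪-lub G₁⊆F G₂⊆F)))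
    (subst (λ k → suc k ≤ ∣ G₁ ∪ G₂ ∣) ∣G₁∣≡r
      (p⊂q⇒∣p∣<∣q∣ (p⊆p∪q G₂ , a , q⊆p∪q G₁ G₂ a∈G₂ , a∉G₁)))

triangle⇒HasWheel : ∀ {n} (K : SimplicialComplex n) {r : ℕ} {S : Subset n} {a b c : Fin n} →
  ∣ S ∣ + 1 ≡ r → a ∉ S → b ∉ S → c ∉ S → a ≢ b → b ≢ c → c ≢ a →
  face K (S ∪ (⁅ a ⁆ ∪ ⁅ b ⁆)) → face K (S ∪ (⁅ b ⁆ ∪ ⁅ c ⁆)) → face K (S ∪ (⁅ c ⁆ ∪ ⁅ a ⁆)) →
  HasWheel K r
triangle⇒HasWheel {n} K {r} {S} {a} {b} {c} ∣S∣+1≡r a∉S b∉S c∉S a≢b b≢c c≢a ab-face bc-face ca-face =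
  S , 0 , v , ∣S∣+1≡r , v-injective , v∉S , rim , r-face c∉S a∉S c≢a ca-face
  where
  v : Fin 3 → Fin n
  v zero             = a
  v (suc zero)       = b
  v (suc (suc zero)) = c

  v-injective : ∀ {i j} → v i ≡ v j → i ≡ j
  v-injective {zero}             {zero}             _ = refl
  v-injective {zero}             {suc zero}         e = ⊥-elim (a≢b e)
  v-injective {zero}             {suc (suc zero)}   e = ⊥-elim (c≢a (sym e))
  v-injective {suc zero}         {zero}             e = ⊥-elim (a≢b (sym e))
  v-injective {suc zero}         {suc zero}         _ = refl
  v-injective {suc zero}         {suc (suc zero)}   e = ⊥-elim (b≢c e)
  v-injective {suc (suc zero)}   {zero}             e = ⊥-elim (c≢a e)
  v-injective {suc (suc zero)}   {suc zero}         e = ⊥-elim (b≢c (sym e))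
  v-injective {suc (suc zero)}   {suc (suc zero)}   _ = refl

  v∉S : ∀ i → v i ∉ S
  v∉S zero             = a∉S
  v∉S (suc zero)       = b∉S
  v∉S (suc (suc zero)) = c∉S

  r-face : ∀ {x y} → x ∉ S → y ∉ S → x ≢ y → face K (S ∪ (⁅ x ⁆ ∪ ⁅ y ⁆)) →
           Sface r K (S ∪ (⁅ x ⁆ ∪ ⁅ y ⁆))
  r-face x∉S y∉S x≢y xy-face = xy-face ,
    trans (∣p∪⁅x,y⁆∣≡2+∣p∣ x∉S y∉S x≢y) (cong suc (trans (+-comm 1 ∣ S ∣) ∣S∣+1≡r))

  rim : ∀ (i : Fin 2) → Sface r K (S ∪ (⁅ v (inject₁ i) ⁆ ∪ ⁅ v (suc i) ⁆))
  rim zero       = r-face a∉S b∉S a≢b ab-face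
  rim (suc zero) = r-face b∉S c∉S b≢c bc-face

lemma3p5 : ∀ {n} (K : SimplicialComplex n) (r : ℕ) → IsDim K r → ¬ HasWheel K r →
    ∀ (F : Subset n) (u : Fin n) → Sface r K F → IsVertex K u → u ∉ F →
    AtMostOne (Nd K r F u)
lemma3p5 K r _ no-wheel F u (F-face , ∣F∣≡1+r) _ u∉F _ _
  (G₁ , G₁⊆F , ∣G₁∣≡r , refl , X-face , _) (G₂ , G₂⊆F , ∣G₂∣≡r , refl , Y-face , _)
  with ∃∈∖⊎⊆ G₂ G₁ | ∃∈∖⊎⊆ G₁ G₂
... | inj₂ G₂⊆G₁ | _ =
  cong (_∪ ⁅ u ⁆) (sym (p⊆q∧∣q∣≤∣p∣⇒p≡q G₂⊆G₁ (≤-reflexive (trans ∣G₁∣≡r (sym ∣G₂∣≡r)))))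
... | inj₁ _ | inj₂ G₁⊆G₂ =
  cong (_∪ ⁅ u ⁆) (p⊆q∧∣q∣≤∣p∣⇒p≡q G₁⊆G₂ (≤-reflexive (trans ∣G₂∣≡r (sym ∣G₁∣≡r))))
... | inj₁ (a , a∈G₂ , a∉G₁) | inj₁ (b , b∈G₁ , b∉G₂) =
  ⊥-elim (no-wheel (triangle⇒HasWheel K ∣S∣+1≡r a∉S b∉S u∉S
    (λ { refl → a∉G₁ b∈G₁ }) (λ { refl → u∉F (G₁⊆F b∈G₁) }) (λ { refl → u∉F (G₂⊆F a∈G₂) })
    (down-closed K (p∪⁅x,y⁆⊆t (⊆-trans S⊆G₁ G₁⊆F) (G₂⊆F a∈G₂) (G₁⊆F b∈G₁)) F-face)
    (down-closed K (p∪⁅x,y⁆⊆t (⊆-trans S⊆G₁ (p⊆p∪q ⁅ u ⁆)) (p⊆p∪q ⁅ u ⁆ b∈G₁) (u∈G∪⁅u⁆ G₁)) X-face)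
    (down-closed K (p∪⁅x,y⁆⊆t (⊆-trans S⊆G₂ (p⊆p∪q ⁅ u ⁆)) (u∈G∪⁅u⁆ G₂) (p⊆p∪q ⁅ u ⁆ a∈G₂)) Y-face)))
  where
  S⊆G₁ : G₁ ∩ G₂ ⊆ G₁
  S⊆G₁ = p∩q⊆p G₁ G₂
  S⊆G₂ : G₁ ∩ G₂ ⊆ G₂
  S⊆G₂ = p∩q⊆q G₁ G₂
  ∣S∣+1≡r : ∣ G₁ ∩ G₂ ∣ + 1 ≡ r
  ∣S∣+1≡r = distinct-r-subsets⇒∣∩∣+1≡r G₁⊆F G₂⊆F ∣F∣≡1+r ∣G₁∣≡r ∣G₂∣≡r a∈G₂ a∉G₁
  a∉S : a ∉ G₁ ∩ G₂
  a∉S = a∉G₁ ∘ S⊆G₁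
  b∉S : b ∉ G₁ ∩ G₂
  b∉S = b∉G₂ ∘ S⊆G₂
  u∉S : u ∉ G₁ ∩ G₂
  u∉S = u∉F ∘ G₁⊆F ∘ S⊆G₁
  u∈G∪⁅u⁆ : ∀ G → u ∈ G ∪ ⁅ u ⁆
  u∈G∪⁅u⁆ G = q⊆p∪q G ⁅ u ⁆ (x∈⁅x⁆ u)
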